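{- Let $n\ge 3$, let $v_1,\dots,v_n$ be distinct vertices with positive weights $w_1,\dots,w_n$, and let $G_1,\dots,G_{n-1}$ be pairwise disjoint graphs with positive real vertex weights, not containing $v_n$, with $v_i\in V(G_i)$ (and weight $w(v_i)=w_i$). Let $K_n$ be the union of $G_1,\dots,G_{n-1}$ and the vertex $v_n$ together with the cycle edges $v_1v_2,\dots,v_{n-1}v_n,v_nv_1$. Let $K_n'$ be the graph obtained from $K_n$ by deleting the edge $v_nv_1$ and adding a new vertex $v_n'$ of weight $w(v_n')=w_n$ adjacent only to $v_1$ (so $K_n'$ is a path-like graph on the path $v_n',v_1,\dots,v_n$). Then $\gamma_w^{00}(K_n,v_n)=\gamma_w(K_n-v_n)$, $\gamma_w^{1}(K_n,v_n)=\gamma^{1}_{w,v_n'}(K_n',v_n)-w_n$, $\gamma_w^{0}(K_n,v_n)=\min\{\gamma_w^{1}(K_n-v_n,v_1),\ \gamma_w^{1}(K_n-v_n,v_{n-1})\}$, $\gamma_w(K_n)=\min\{\gamma_w^{1}(K_n,v_n),\gamma_w^{0}(K_n,v_n)\}$.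
   Context: For a graph $H$ with weights $w:V(H)\to\mathbb{R}_+$ and $D\subseteq V(H)$, $w(D)=\sum_{x\in D}w(x)$; $D$ is dominating if every vertex is in $D$ or adjacent to a vertex of $D$; $\gamma_w(H)$ is the minimum weight of a dominating set. For a vertex $v$ of $H$: $\gamma_w^{00}(H,v)=\gamma_w(H-v)$; $\gamma_w^{1}(H,v)=\min\{w(D): D \text{ dominating set of } H,\ v\in D\}$; $\gamma_w^{0}(H,v)=\min\{w(D): D\text{ dominating set of } H,\ v\notin D\}$. For distinct vertices $x,u$ of $H$: $\gamma^{1}_{w,x}(H,u)=\min\{w(D): D\text{ dominating set of } H,\ \{u,x\}\subseteq D\}$. -}

module Defs where

open import Level using (Level; _⊔_) renaming (suc to lsuc; zero to lzero)
open import Data.Nat using (ℕ; zero; suc; _∸_)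
open import Data.Fin using (Fin; toℕ) renaming (_≟_ to _≟F_)
open import Data.Bool using (Bool; true; false; if_then_else_; T)
open import Data.Unit using (⊤; tt)
open import Data.Product using (Σ; ∃; _×_; _,_; proj₁; proj₂)
open import Data.Sum using (_⊎_; inj₁; inj₂)
open import Data.Maybe using (Maybe; just; nothing)
open import Data.List using (List; []; _∷_; _++_; map; concatMap; mapMaybe; foldr)
open import Data.List.Membership.Propositional using (_∈_)
open import Data.List.Relation.Unary.Unique.Propositional using (Unique)
open import Data.List.Relation.Unary.All using (All)
open import Relation.Nullary using (¬_; Dec; yes; no)
open import Relation.Nullary.Decidable using (False; fromWitnessFalse)
open import Relation.Binary using (IsTotalOrder; DecidableEquality)
open import Relation.Binary.PropositionalEquality using (_≡_; refl; cong)
open import Algebra.Bundles using (AbelianGroup)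
open import Data.List.Base using (allFin)
open import Data.Empty using (⊥)
import Data.Product.Properties as ×P
import Data.Sum.Properties as ⊎P
import Data.Unit.Properties as ⊤P

-- Weights: a totally ordered abelian group (e.g. (ℝ,+,≤)).

record OrderedAbelianGroup (c ℓ : Level) : Set (lsuc (c ⊔ ℓ)) where
  field
    abelianGroup : AbelianGroup c ℓ
  open AbelianGroup abelianGroup public
  field
    _≤_          : Carrier → Carrier → Set ℓ
    isTotalOrder : IsTotalOrder _≈_ _≤_
    ∙-monoˡ-≤    : ∀ {a b} (d : Carrier) → a ≤ b → (a ∙ d) ≤ (b ∙ d)

  Positive : Carrier → Set ℓ
  Positive x = (ε ≤ x) × ¬ (x ≈ ε)

module WithWeights {c ℓ : Level} (O : OrderedAbelianGroup c ℓ) where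
  open OrderedAbelianGroup O using (Carrier; _≈_; _∙_; ε; _≤_; Positive)

  record WGraph : Set (lsuc lzero ⊔ c) where
    field
      V     : Set
      _~_   : V → V → Set
      w     : V → Carrier
      elems : List V
      _≟_   : DecidableEquality V

  record IsFinitePosGraph (H : WGraph) : Set ℓ where
    open WGraph H
    field
      complete : ∀ x → x ∈ elems
      unique   : Unique elems
      sym~     : ∀ {x y} → x ~ y → y ~ x
      irrefl~  : ∀ x → ¬ (x ~ x)
      positive : ∀ x → Positive (w x)

  module _ (H : WGraph) where
    open WGraph H

    Subset : Set
    Subset = V → Bool

    weight : Subset → Carrier
    weight D = foldr (λ x acc → (if D x then w x else ε) ∙ acc) ε elems

    Dominating : Subset → Set
    Dominating D = ∀ x → (D x ≡ true) ⊎ (∃ λ y → (x ~ y) × (D y ≡ true))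

  IsMinWeight : (H : WGraph) → (Subset H → Set) → Carrier → Set ℓ
  IsMinWeight H P m =
    (∃ λ D → P D × (weight H D ≈ m)) × (∀ D → P D → m ≤ weight H D)

  IsMin2 : Carrier → Carrier → Carrier → Set ℓ
  IsMin2 m a b = ((m ≈ a) ⊎ (m ≈ b)) × (m ≤ a) × (m ≤ b)

  T-irr : ∀ {b} (p q : T b) → p ≡ q
  T-irr {true} _ _ = refl

  delete : (H : WGraph) → WGraph.V H → WGraph
  delete H v = record
    { V     = Σ V (λ x → False (x ≟ v))
    ; _~_   = λ x y → proj₁ x ~ proj₁ y
    ; w     = λ x → w (proj₁ x)
    ; elems = mapMaybe keep elems
    ; _≟_   = dec
    }
    where
    open WGraph H
    keep : V → Maybe (Σ V (λ x → False (x ≟ v)))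
    keep x with x ≟ v
    ... | yes _ = nothing
    ... | no ne = just (x , fromWitnessFalse ne)
    dec : DecidableEquality (Σ V (λ x → False (x ≟ v)))
    dec (x , p) (y , q) with x ≟ y
    ... | no ne = no (λ e → ne (cong proj₁ e))
    ... | yes refl = yes (cong (x ,_) (T-irr p q))

  IsGamma : WGraph → Carrier → Set ℓ
  IsGamma H = IsMinWeight H (Dominating H)

  IsGamma00 : (H : WGraph) → WGraph.V H → Carrier → Set ℓ
  IsGamma00 H v = IsGamma (delete H v)

  IsGamma1 : (H : WGraph) → WGraph.V H → Carrier → Set ℓ
  IsGamma1 H v = IsMinWeight H (λ D → Dominating H D × (D v ≡ true))

  IsGamma0 : (H : WGraph) → WGraph.V H → Carrier → Set ℓ
  IsGamma0 H v = IsMinWeight H (λ D → Dominating H D × (D v ≡ false))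

  IsGamma1x : (H : WGraph) → WGraph.V H → WGraph.V H → Carrier → Set ℓ
  IsGamma1x H x u =
    IsMinWeight H (λ D → Dominating H D × (D u ≡ true) × (D x ≡ true))

  -- The graphs K_n and K_n' of Theorem 5.
  --   n      : number of cycle vertices
  --   G i    : the graph G_{i+1}, for i : Fin (n ∸ 1)   (i.e. G_1 … G_{n-1})
  --   v i    : the vertex v_{i+1} ∈ V(G_{i+1})
  --   wn     : the weight w_n of v_n
  -- Vertices of K_n: the disjoint union of the V(G_i), plus v_n = inj₂ tt.
  module Cycle (n : ℕ) (G : Fin (n ∸ 1) → WGraph)
               (v : (i : Fin (n ∸ 1)) → WGraph.V (G i)) (wn : Carrier) where

    VK : Set
    VK = Σ (Fin (n ∸ 1)) (λ i → WGraph.V (G i)) ⊎ ⊤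

    cyc : Fin (n ∸ 1) → VK
    cyc i = inj₁ (i , v i)

    vn : VK
    vn = inj₂ tt

    -- the (one-directional) edges of K_n other than v_n v_1:
    -- edges of the G_i, cycle edges v_i v_{i+1} (1 ≤ i ≤ n-2), and v_{n-1} v_n
    data Base : VK → VK → Set where
      inner : ∀ {i x y} → WGraph._~_ (G i) x y → Base (inj₁ (i , x)) (inj₁ (i , y))
      path  : ∀ {i j} → toℕ j ≡ suc (toℕ i) → Base (cyc i) (cyc j)
      last  : ∀ {i} → suc (toℕ i) ≡ n ∸ 1 → Base (cyc i) vn

    Closing : VK → VK → Set
    Closing x y = (x ≡ vn) × (∃ λ i → (toℕ i ≡ 0) × (y ≡ cyc i))

    AdjK : VK → VK → Set
    AdjK x y = Base x y ⊎ Base y x ⊎ Closing x y ⊎ Closing y x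

    wK : VK → Carrier
    wK (inj₁ (i , x)) = WGraph.w (G i) x
    wK (inj₂ _)       = wn

    elemsK : List VK
    elemsK = map inj₁ (concatMap (λ i → map (i ,_) (WGraph.elems (G i))) (allFin (n ∸ 1)))
             ++ (vn ∷ [])

    decK : DecidableEquality VK
    decK = ⊎P.≡-dec (×P.≡-dec _≟F_ (λ {i} → WGraph._≟_ (G i))) ⊤P._≟_

    K : WGraph
    K = record { V = VK ; _~_ = AdjK ; w = wK ; elems = elemsK ; _≟_ = decK }

    Kdel : WGraph
    Kdel = delete K vn

    cycDel : Fin (n ∸ 1) → WGraph.V Kdel
    cycDel i = cyc i , fromWitnessFalse {a? = decK (cyc i) vn} (λ ())

    VK' : Set
    VK' = VK ⊎ ⊤

    vn' : VK'
    vn' = inj₂ tt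

    vnK' : VK'
    vnK' = inj₁ vn

    Pendant : VK' → VK' → Set
    Pendant x y = (x ≡ vn') × (∃ λ i → (toℕ i ≡ 0) × (y ≡ inj₁ (cyc i)))

    AdjK' : VK' → VK' → Set
    AdjK' (inj₁ x) (inj₁ y) = Base x y ⊎ Base y x
    AdjK' x y = Pendant x y ⊎ Pendant y x

    wK' : VK' → Carrier
    wK' (inj₁ x) = wK x
    wK' (inj₂ _) = wn

    K' : WGraph
    K' = record { V = VK' ; _~_ = AdjK' ; w = wK'
                ; elems = map inj₁ elemsK ++ (vn' ∷ [])
                ; _≟_ = ⊎P.≡-dec decK ⊤P._≟_ }

-- A dominating set of K_n either contains v_n or not. If it does not, some
-- cycle neighbour of v_n, i.e. v_1 or v_{n-1}, lies in it, and removing v_n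
-- gives a dominating set of K_n - v_n through that neighbour; conversely such a
-- set dominates v_n in K_n. If it does contain v_n, it dominates v_1 through
-- v_n, and the same is achieved in K_n' by the pendant copy v_n' of v_n, which
-- costs the extra w_n. Each identity thus comes from weight-preserving (or
-- weight-shifting) translations between the two families of sets being
-- minimised.
module Submission where

open import Defs
open import Level using (Level)
open import Data.Nat using (ℕ; suc; _∸_) renaming (_≤_ to _≤ℕ_)
open import Data.Nat.Properties using (suc-injective)
open import Data.Fin using (Fin; toℕ)
open import Data.Fin.Properties using (toℕ-injective)
open import Data.Bool using (Bool; true; false; if_then_else_)
open import Data.Maybe using (Maybe; just; nothing)
open import Data.List using (List; []; _∷_; foldr; map; mapMaybe)
open import Data.List.Properties using (foldr-++; foldr-map)
open import Data.Product using (_×_; _,_; proj₁; proj₂; Σ; ∃)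
open import Data.Sum using (_⊎_; inj₁; inj₂; [_,_]′) renaming (map to map-⊎)
open import Data.Unit using (tt)
open import Data.Empty using (⊥-elim)
open import Function using (_∘_)
open import Relation.Nullary using (Dec; yes; no)
open import Relation.Nullary.Decidable using (False; fromWitnessFalse; toSum)
open import Relation.Binary using (IsTotalOrder)
open import Relation.Binary.PropositionalEquality
  using (_≡_; _≢_; refl; sym; trans; cong; subst)

import Algebra.Properties.Group

module Domination {c ℓ : Level} (O : OrderedAbelianGroup c ℓ) where
  open OrderedAbelianGroup O
    using (Carrier; _≈_; _-_; _∙_; ε; _⁻¹; _≤_; isTotalOrder; ∙-monoˡ-≤; ∙-cong; assoc; identityˡ; identityʳ)
    renaming (refl to ≈-refl; sym to ≈-sym; trans to ≈-trans)
  open WithWeights O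
  open Algebra.Properties.Group (OrderedAbelianGroup.group O) using (//-rightDividesʳ)
  open IsTotalOrder isTotalOrder
    using (antisym; reflexive; ≲-respʳ-≈) renaming (trans to ≤-trans)
  open WGraph using (V; elems)

  ≈-from-shifted-bounds : ∀ {a b k} → b ≤ (a ∙ k) → a ≤ (b ∙ k ⁻¹) → a ≈ (b ∙ k ⁻¹)
  ≈-from-shifted-bounds {a} {b} {k} b≤a∙k a≤b∙k⁻¹ =
    antisym a≤b∙k⁻¹ (≲-respʳ-≈ (//-rightDividesʳ k a) (∙-monoˡ-≤ (k ⁻¹) b≤a∙k))

  ≤-∙ε : ∀ {x y} → x ≈ y → x ≤ (y ∙ ε)
  ≤-∙ε x≈y = reflexive (≈-trans x≈y (≈-sym (identityʳ _)))

  foldr-∙-start : {A : Set} (t : A → Carrier) (z : Carrier) (xs : List A) →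
    foldr (λ x acc → t x ∙ acc) z xs ≈ foldr (λ x acc → t x ∙ acc) ε xs ∙ z
  foldr-∙-start t z []       = ≈-sym (identityˡ z)
  foldr-∙-start t z (x ∷ xs) =
    ≈-trans (∙-cong ≈-refl (foldr-∙-start t z xs)) (≈-sym (assoc _ _ _))

  foldr-∙-mapMaybe : {A B : Set} (g : A → Maybe B) (s : A → Carrier) (t : B → Carrier) →
    (∀ x → (g x ≡ nothing × s x ≈ ε) ⊎ (∃ λ y → g x ≡ just y × t y ≈ s x)) →
    ∀ xs → foldr (λ y acc → t y ∙ acc) ε (mapMaybe g xs)
         ≈ foldr (λ x acc → s x ∙ acc) ε xs
  foldr-∙-mapMaybe g s t classify []       = ≈-refl
  foldr-∙-mapMaybe g s t classify (x ∷ xs) with g x | classify x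
  ... | .nothing  | inj₁ (refl , sx≈ε) =
    ≈-trans (≈-sym (identityˡ _)) (∙-cong (≈-sym sx≈ε) (foldr-∙-mapMaybe g s t classify xs))
  ... | .(just y) | inj₂ (y , refl , ty≈sx) =
    ∙-cong ty≈sx (foldr-∙-mapMaybe g s t classify xs)

  record Reduces (k : Carrier) (H : WGraph) (P : Subset H → Set)
                 (H' : WGraph) (Q : Subset H' → Set) : Set ℓ where
    constructor reduces
    field reduce : ∀ D → P D → ∃ λ D' → Q D' × (weight H' D' ≤ (weight H D ∙ k))
  open Reduces

  Reduces-id : ∀ {H} {P Q : Subset H → Set} → (∀ D → P D → Q D) → Reduces ε H P H Q
  Reduces-id P⇒Q = reduces λ D PD → D , P⇒Q D PD , ≤-∙ε ≈-refl

  IsMinWeight-unique : ∀ {H P a b} → IsMinWeight H P a → IsMinWeight H P b → a ≈ b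
  IsMinWeight-unique ((Da , PDa , wDa≈a) , a-min) ((Db , PDb , wDb≈b) , b-min) =
    antisym (≲-respʳ-≈ wDb≈b (a-min Db PDb)) (≲-respʳ-≈ wDa≈a (b-min Da PDa))

  IsMinWeight-mono : ∀ {k H P H' Q a b} → Reduces k H P H' Q →
    IsMinWeight H P a → IsMinWeight H' Q b → b ≤ (a ∙ k)
  IsMinWeight-mono P⇒Q ((Da , PDa , wDa≈a) , _) (_ , b-min) with reduce P⇒Q Da PDa
  ... | D' , QD' , wD'≤ = ≤-trans (b-min D' QD') (≲-respʳ-≈ (∙-cong wDa≈a ≈-refl) wD'≤)

  IsMinWeight-mono-⊎ : ∀ {k H P H' Q R a b c} → Reduces k H P H' (λ D → Q D ⊎ R D) →
    IsMinWeight H P a → IsMinWeight H' Q b → IsMinWeight H' R c →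
    (b ≤ (a ∙ k)) ⊎ (c ≤ (a ∙ k))
  IsMinWeight-mono-⊎ P⇒Q⊎R ((Da , PDa , wDa≈a) , _) (_ , b-min) (_ , c-min)
    with reduce P⇒Q⊎R Da PDa
  ... | D' , inj₁ QD' , wD'≤ = inj₁ (≤-trans (b-min D' QD') (≲-respʳ-≈ (∙-cong wDa≈a ≈-refl) wD'≤))
  ... | D' , inj₂ RD' , wD'≤ = inj₂ (≤-trans (c-min D' RD') (≲-respʳ-≈ (∙-cong wDa≈a ≈-refl) wD'≤))

  IsMinWeight-min2 : ∀ {H P H' Q R a b c} →
    Reduces ε H' Q H P → Reduces ε H' R H P → Reduces ε H P H' (λ D → Q D ⊎ R D) →
    IsMinWeight H P a → IsMinWeight H' Q b → IsMinWeight H' R c → IsMin2 a b c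
  IsMinWeight-min2 {a = a} {b} {c} Q⇒P R⇒P P⇒Q⊎R a-min b-min c-min = a≈b⊎a≈c , a≤b , a≤c
    where
    a≤b : a ≤ b
    a≤b = ≲-respʳ-≈ (identityʳ _) (IsMinWeight-mono Q⇒P b-min a-min)
    a≤c : a ≤ c
    a≤c = ≲-respʳ-≈ (identityʳ _) (IsMinWeight-mono R⇒P c-min a-min)
    a≈b⊎a≈c : (a ≈ b) ⊎ (a ≈ c)
    a≈b⊎a≈c with IsMinWeight-mono-⊎ P⇒Q⊎R a-min b-min c-min
    ... | inj₁ b≤a = inj₁ (antisym a≤b (≲-respʳ-≈ (identityʳ _) b≤a))
    ... | inj₂ c≤a = inj₂ (antisym a≤c (≲-respʳ-≈ (identityʳ _) c≤a))

  IsGamma-min2 : ∀ {a b c} (H : WGraph) (x : V H) →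
    IsGamma H a → IsGamma1 H x b → IsGamma0 H x c → IsMin2 a b c
  IsGamma-min2 H x = IsMinWeight-min2 (Reduces-id {H} (λ _ → proj₁)) (Reduces-id {H} (λ _ → proj₁)) (reduces split)
    where
    DominatingWith : Bool → Subset H → Set
    DominatingWith b D = Dominating H D × (D x ≡ b)

    split : ∀ D → Dominating H D →
      ∃ λ D' → (DominatingWith true D' ⊎ DominatingWith false D') × (weight H D' ≤ (weight H D ∙ ε))
    split D dom with D x in Dx
    ... | true  = D , inj₁ (dom , Dx) , ≤-∙ε ≈-refl
    ... | false = D , inj₂ (dom , Dx) , ≤-∙ε ≈-refl

  ifNot : {A : Set} (a? : Dec A) → (False a? → Bool) → Bool
  ifNot (yes _) f = false
  ifNot (no  _) f = f tt

  ifNot-yes : {A : Set} (a? : Dec A) (f : False a? → Bool) → A → ifNot a? f ≡ false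
  ifNot-yes (yes _) f a = refl
  ifNot-yes (no ¬a) f a = ⊥-elim (¬a a)

  ifNot-no : {A : Set} (a? : Dec A) (f : False a? → Bool) (¬a : False a?) → f ¬a ≡ ifNot a? f
  ifNot-no (no _) f _ = refl

  module _ (H : WGraph) (v : V H) where
    open WGraph H using (_~_; _≟_; w)

    -- `delete` filters the vertex list through a function local to its
    -- definition; unification recovers it.
    deletionFilter : Σ (V H → Maybe (V (delete H v))) λ g → mapMaybe g (elems H) ≡ elems (delete H v)
    deletionFilter = _ , refl

    deletionFilter-classify : ∀ x →
      (proj₁ deletionFilter x ≡ nothing × x ≡ v) ⊎
      (∃ λ y → proj₁ deletionFilter x ≡ just y × proj₁ y ≡ x)
    deletionFilter-classify x with x ≟ v
    ... | yes x≡v = inj₁ (refl , x≡v)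
    ... | no  _   = inj₂ (_ , refl , refl)

    weight-delete : (D : Subset H) (D' : Subset (delete H v)) → D v ≡ false →
      (∀ y → D' y ≡ D (proj₁ y)) → weight (delete H v) D' ≈ weight H D
    weight-delete D D' Dv D'≡D =
      subst (λ xs → foldr _ ε xs ≈ weight H D) (proj₂ deletionFilter)
        (foldr-∙-mapMaybe (proj₁ deletionFilter) _ _ classify (elems H))
      where
      term : Subset H → V H → Carrier
      term D x = if D x then w x else ε

      term′ : V (delete H v) → Carrier
      term′ y = if D' y then w (proj₁ y) else ε

      classify : ∀ x → (proj₁ deletionFilter x ≡ nothing × term D x ≈ ε) ⊎
                       (∃ λ y → proj₁ deletionFilter x ≡ just y × term′ y ≈ term D x)
      classify x with deletionFilter-classify x
      ... | inj₁ (g≡nothing , refl) = inj₁ (g≡nothing , deleted-term)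
        where deleted-term : term D v ≈ ε
              deleted-term rewrite Dv = ≈-refl
      ... | inj₂ (y , g≡just , refl) = inj₂ (y , g≡just , kept-term)
        where kept-term : term′ y ≈ term D (proj₁ y)
              kept-term rewrite D'≡D y = ≈-refl

    restrict : Subset H → Subset (delete H v)
    restrict D = D ∘ proj₁

    extend : Subset (delete H v) → Subset H
    extend D' x = ifNot (x ≟ v) (λ x≢v → D' (x , x≢v))

    extend-deleted : (D' : Subset (delete H v)) → extend D' v ≡ false
    extend-deleted D' = ifNot-yes (v ≟ v) _ refl

    extend-restrict : (D' : Subset (delete H v)) → ∀ y → D' y ≡ extend D' (proj₁ y)
    extend-restrict D' (x , x≢v) = ifNot-no (x ≟ v) _ x≢v

    weight-restrict : (D : Subset H) → D v ≡ false → weight (delete H v) (restrict D) ≈ weight H D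
    weight-restrict D Dv = weight-delete D (restrict D) Dv (λ _ → refl)

    weight-extend : (D' : Subset (delete H v)) → weight (delete H v) D' ≈ weight H (extend D')
    weight-extend D' = weight-delete (extend D') D' (extend-deleted D') (extend-restrict D')

    member-≢ : (D : Subset H) → D v ≡ false → ∀ {x} → D x ≡ true → x ≢ v
    member-≢ D Dv Dx refl with trans (sym Dv) Dx
    ... | ()

    restrict-dominating : (D : Subset H) → Dominating H D → D v ≡ false →
      Dominating (delete H v) (restrict D)
    restrict-dominating D dom Dv (x , _) with dom x
    ... | inj₁ Dx = inj₁ Dx
    ... | inj₂ (y , x~y , Dy) = inj₂ ((y , fromWitnessFalse (member-≢ D Dv Dy)) , x~y , Dy)

    extend-dominating : (D' : Subset (delete H v)) → Dominating (delete H v) D' →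
      (∃ λ y → v ~ proj₁ y × D' y ≡ true) → Dominating H (extend D')
    extend-dominating D' dom (y , v~y , D'y) x = [ at-v , off-v ]′ (toSum (x ≟ v))
      where
      Dominated : Set
      Dominated = (extend D' x ≡ true) ⊎ (∃ λ z → x ~ z × extend D' z ≡ true)

      at-v : x ≡ v → Dominated
      at-v refl = inj₂ (proj₁ y , v~y , trans (sym (extend-restrict D' y)) D'y)

      off-v : x ≢ v → Dominated
      off-v x≢v with dom (x , fromWitnessFalse x≢v)
      ... | inj₁ D'x = inj₁ (trans (sym (extend-restrict D' _)) D'x)
      ... | inj₂ (z , x~z , D'z) = inj₂ (proj₁ z , x~z , trans (sym (extend-restrict D' z)) D'z)

  module _ (n : ℕ) (G : Fin (n ∸ 1) → WGraph) (v : (i : Fin (n ∸ 1)) → V (G i))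
           (wn : Carrier) where
    open Cycle n G v wn

    withPendant : Subset K → Subset K'
    withPendant D (inj₁ x) = D x
    withPendant D (inj₂ _) = true

    weight-K' : (D : Subset K') → D vn' ≡ true → weight K' D ≈ (weight K (D ∘ inj₁) ∙ wn)
    weight-K' D Dvn'
      rewrite foldr-++ (λ x acc → (if D x then wK' x else ε) ∙ acc) ε (map inj₁ elemsK) (vn' ∷ [])
            | foldr-map (λ x acc → (if D x then wK' x else ε) ∙ acc) inj₁
                        ((if D vn' then wn else ε) ∙ ε) elemsK
            | Dvn'
      = ≈-trans (foldr-∙-start _ (wn ∙ ε) elemsK) (∙-cong ≈-refl (identityʳ wn))

    withPendant-dominating : (D : Subset K) → Dominating K D → D vn ≡ true →
      Dominating K' (withPendant D)
    withPendant-dominating D dom Dvn (inj₂ tt)        = inj₁ refl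
    withPendant-dominating D dom Dvn (inj₁ (inj₂ tt)) = inj₁ Dvn
    withPendant-dominating D dom Dvn (inj₁ (inj₁ x)) with dom (inj₁ x)
    ... | inj₁ Dx = inj₁ Dx
    ... | inj₂ (inj₁ y , inj₁ x→y , Dy)                  = inj₂ (inj₁ (inj₁ y) , inj₁ x→y , Dy)
    ... | inj₂ (inj₁ y , inj₂ (inj₁ y→x) , Dy)           = inj₂ (inj₁ (inj₁ y) , inj₂ y→x , Dy)
    ... | inj₂ (inj₁ y , inj₂ (inj₂ (inj₁ (() , _))) , _)
    ... | inj₂ (inj₁ y , inj₂ (inj₂ (inj₂ (() , _))) , _)
    ... | inj₂ (inj₂ tt , inj₁ x→vn , Dy)                = inj₂ (inj₁ vn , inj₁ x→vn , Dy)
    ... | inj₂ (inj₂ tt , inj₂ (inj₁ ()) , _)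
    ... | inj₂ (inj₂ tt , inj₂ (inj₂ (inj₁ (() , _))) , _)
    -- v_1 was dominated by v_n across the deleted edge; v_n' takes over.
    ... | inj₂ (inj₂ tt , inj₂ (inj₂ (inj₂ (refl , i , i≡0 , refl))) , _) =
      inj₂ (vn' , inj₂ (refl , i , i≡0 , refl) , refl)

    dropPendant-dominating : (D : Subset K') → Dominating K' D → D vnK' ≡ true →
      Dominating K (D ∘ inj₁)
    dropPendant-dominating D dom Dvn (inj₂ tt) = inj₁ Dvn
    dropPendant-dominating D dom Dvn (inj₁ x) with dom (inj₁ (inj₁ x))
    ... | inj₁ Dx = inj₁ Dx
    ... | inj₂ (inj₁ y , inj₁ x→y , Dy) = inj₂ (y , inj₁ x→y , Dy)
    ... | inj₂ (inj₁ y , inj₂ y→x , Dy) = inj₂ (y , inj₂ (inj₁ y→x) , Dy)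
    ... | inj₂ (inj₂ tt , inj₁ (() , _) , _)
    ... | inj₂ (inj₂ tt , inj₂ (_ , i , i≡0 , refl) , _) =
      inj₂ (vn , inj₂ (inj₂ (inj₂ (refl , i , i≡0 , refl))) , Dvn)

    IsGamma1-pendant : ∀ {a b} → IsGamma1 K vn a → IsGamma1x K' vn' vnK' b → a ≈ (b - wn)
    IsGamma1-pendant a-min b-min =
      ≈-from-shifted-bounds (IsMinWeight-mono addPendant a-min b-min)
                            (IsMinWeight-mono dropPendant b-min a-min)
      where
      addPendant : Reduces wn K (λ D → Dominating K D × (D vn ≡ true))
                              K' (λ D → Dominating K' D × (D vnK' ≡ true) × (D vn' ≡ true))
      addPendant = reduces λ D (dom , Dvn) →
        withPendant D , (withPendant-dominating D dom Dvn , Dvn , refl) , reflexive (weight-K' (withPendant D) refl)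

      dropPendant : Reduces (wn ⁻¹) K' (λ D → Dominating K' D × (D vnK' ≡ true) × (D vn' ≡ true))
                                    K  (λ D → Dominating K D × (D vn ≡ true))
      dropPendant = reduces λ D (dom , Dvn , Dvn') →
        D ∘ inj₁ , (dropPendant-dominating D dom Dvn , Dvn) ,
        reflexive (≈-trans (≈-sym (//-rightDividesʳ wn _)) (∙-cong (≈-sym (weight-K' D Dvn')) ≈-refl))

    module _ (i₁ iₗ : Fin (n ∸ 1)) (i₁≡0 : toℕ i₁ ≡ 0) (iₗ≡n-2 : suc (toℕ iₗ) ≡ n ∸ 1) where

      vn-neighbour : ∀ {y} → AdjK vn y → y ≡ cyc i₁ ⊎ y ≡ cyc iₗ
      vn-neighbour (inj₁ ())
      vn-neighbour (inj₂ (inj₁ (last {i} i≡n-2))) =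
        inj₂ (cong cyc (toℕ-injective (suc-injective (trans i≡n-2 (sym iₗ≡n-2)))))
      vn-neighbour (inj₂ (inj₂ (inj₁ (refl , i , i≡0 , refl)))) =
        inj₁ (cong cyc (toℕ-injective (trans i≡0 (sym i₁≡0))))
      vn-neighbour (inj₂ (inj₂ (inj₂ (_ , _ , _ , ()))))

      vn~cyc-i₁ : AdjK vn (cyc i₁)
      vn~cyc-i₁ = inj₂ (inj₂ (inj₁ (refl , i₁ , i₁≡0 , refl)))

      vn~cyc-iₗ : AdjK vn (cyc iₗ)
      vn~cyc-iₗ = inj₂ (inj₁ (last iₗ≡n-2))

      dominating-cyc-neighbour : (D : Subset K) → Dominating K D → D vn ≡ false →
        D (cyc i₁) ≡ true ⊎ D (cyc iₗ) ≡ true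
      dominating-cyc-neighbour D dom Dvn with dom vn
      ... | inj₁ Dvn≡true = ⊥-elim (member-≢ K vn D Dvn Dvn≡true refl)
      ... | inj₂ (y , vn~y , Dy) with vn-neighbour vn~y
      ...   | inj₁ refl = inj₁ Dy
      ...   | inj₂ refl = inj₂ Dy

      IsGamma0-delete : ∀ {a b c} → IsGamma0 K vn a →
        IsGamma1 Kdel (cycDel i₁) b → IsGamma1 Kdel (cycDel iₗ) c → IsMin2 a b c
      IsGamma0-delete = IsMinWeight-min2 (extendThrough vn~cyc-i₁) (extendThrough vn~cyc-iₗ) restriction
        where
        extendThrough : ∀ {i} → AdjK vn (cyc i) →
          Reduces ε Kdel (λ D → Dominating Kdel D × (D (cycDel i) ≡ true))
                    K    (λ D → Dominating K D × (D vn ≡ false))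
        extendThrough vn~cyc = reduces λ D (dom , Dcyc) →
          extend K vn D , (extend-dominating K vn D dom (cycDel _ , vn~cyc , Dcyc) , extend-deleted K vn D) ,
          ≤-∙ε (≈-sym (weight-extend K vn D))

        restriction : Reduces ε K (λ D → Dominating K D × (D vn ≡ false)) Kdel
          (λ D → (Dominating Kdel D × (D (cycDel i₁) ≡ true)) ⊎ (Dominating Kdel D × (D (cycDel iₗ) ≡ true)))
        restriction = reduces λ D (dom , Dvn) →
          restrict K vn D ,
          map-⊎ (restrict-dominating K vn D dom Dvn ,_) (restrict-dominating K vn D dom Dvn ,_)
                       (dominating-cyc-neighbour D dom Dvn) ,
          ≤-∙ε (weight-restrict K vn D Dvn)

mainTheorem5 : ∀ {c ℓ : Level} (O : OrderedAbelianGroup c ℓ) →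
    let open OrderedAbelianGroup O
        open WithWeights O
    in (n : ℕ) → 3 ≤ℕ n →
       (G : Fin (n ∸ 1) → WGraph) → (∀ i → IsFinitePosGraph (G i)) →
       (v : (i : Fin (n ∸ 1)) → WGraph.V (G i)) →
       (wn : Carrier) → Positive wn →
       let open Cycle n G v wn
       in (i₁ iₗ : Fin (n ∸ 1)) → toℕ i₁ ≡ 0 → suc (toℕ iₗ) ≡ n ∸ 1 →
          (∀ a b → IsGamma00 K vn a → IsGamma Kdel b → a ≈ b)
          × (∀ a b → IsGamma1 K vn a → IsGamma1x K' vn' vnK' b → a ≈ (b - wn))
          × (∀ a b c → IsGamma0 K vn a → IsGamma1 Kdel (cycDel i₁) b →
               IsGamma1 Kdel (cycDel iₗ) c → IsMin2 a b c)
          × (∀ a b c → IsGamma K a → IsGamma1 K vn b → IsGamma0 K vn c →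
               IsMin2 a b c)
mainTheorem5 O n _ G _ v wn _ i₁ iₗ i₁≡0 iₗ≡n-2 =
    (λ _ _ → IsMinWeight-unique {H = Kdel})
  , (λ _ _ → IsGamma1-pendant n G v wn)
  , (λ _ _ _ → IsGamma0-delete n G v wn i₁ iₗ i₁≡0 iₗ≡n-2)
  , (λ _ _ _ → IsGamma-min2 K vn)
  where
  open Domination O
  open WithWeights.Cycle O n G v wn
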